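{- For every $n\ge0$, $\#\mathrm{Av}_n([1234],[1324],[1423])=\#\mathrm{Av}_n([1324],[1423],[1432])$. Moreover, for $n\ge2$, $\#\mathrm{Av}_n([1234],[1324],[1423])=n-1$.
   Context: For a linear permutation $\pi=\pi_1\ldots\pi_n$ of $[n]$, the cyclic permutation $[\pi]$ is the set of all rotations of $\pi$. A linear permutation $\sigma$ contains $\pi$ if some subsequence of $\sigma$ is order isomorphic to $\pi$ (same relative order). A cyclic permutation $[\sigma]$ contains $[\pi]$ if some rotation of $\sigma$ contains $\pi$; otherwise it avoids $[\pi]$. For a set of cyclic patterns $[\Pi]$, $\mathrm{Av}_n[\Pi]$ denotes the set of cyclic permutations of length $n$ avoiding every pattern in $[\Pi]$. -}

module Defs where

open import Data.Bool using (Bool; true; false; _∧_; _∨_; not; if_then_else_)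
open import Data.Nat using (ℕ; zero; suc; _<ᵇ_; _≡ᵇ_)
open import Data.List using (List; []; _∷_; _++_; map; concatMap; length; drop; take; upTo; filterᵇ; zip)
open import Data.Bool.ListAction using (all; any)
open import Data.Product using (_,_)
open import Relation.Nullary.Decidable using (⌊_⌋)
open import Relation.Unary using (Decidable)

-- Permutations of [n] are lists of the distinct naturals 0,…,n-1
-- (any order-isomorphic labelling is equivalent for pattern purposes).

insertEverywhere : ℕ → List ℕ → List (List ℕ)
insertEverywhere x []       = (x ∷ []) ∷ []
insertEverywhere x (y ∷ ys) = (x ∷ y ∷ ys) ∷ map (y ∷_) (insertEverywhere x ys)

perms : ℕ → List (List ℕ)
perms zero    = [] ∷ []
perms (suc n) = concatMap (insertEverywhere n) (perms n)

subseqs : List ℕ → List (List ℕ)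
subseqs []       = [] ∷ []
subseqs (x ∷ xs) = map (x ∷_) (subseqs xs) ++ subseqs xs

_⇔ᵇ_ : Bool → Bool → Bool
true  ⇔ᵇ b = b
false ⇔ᵇ b = not b

orderIso : List ℕ → List ℕ → Bool
orderIso []       []       = true
orderIso (x ∷ xs) (y ∷ ys) =
  all (λ { (x' , y') → (x <ᵇ x') ⇔ᵇ (y <ᵇ y') }) (zip xs ys) ∧ orderIso xs ys
orderIso _        _        = false

contains : List ℕ → List ℕ → Bool
contains σ π = any (λ s → orderIso s π) (subseqs σ)

rotate : ℕ → List ℕ → List ℕ
rotate k σ = drop k σ ++ take k σ

-- all rotations of σ (rotation by 0 … length σ; the last duplicates the first)
rotations : List ℕ → List (List ℕ)
rotations σ = map (λ k → rotate k σ) (upTo (suc (length σ)))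

_==_ : List ℕ → List ℕ → Bool
[]       == []       = true
(x ∷ xs) == (y ∷ ys) = (x ≡ᵇ y) ∧ (xs == ys)
_        == _        = false

sameCyclic : List ℕ → List ℕ → Bool
sameCyclic σ τ = any (λ r → r == τ) (rotations σ)

cycContains : List ℕ → List ℕ → Bool
cycContains σ π = any (λ r → contains r π) (rotations σ)

avoidsAll : List (List ℕ) → List ℕ → Bool
avoidsAll Π σ = all (λ π → not (cycContains σ π)) Π

classReps : List (List ℕ) → List (List ℕ) → List (List ℕ)
classReps seen []       = seen
classReps seen (x ∷ xs) =
  if any (sameCyclic x) seen then classReps seen xs else classReps (x ∷ seen) xs

-- #Av_n[Π]: number of cyclic permutations (rotation classes of linear
-- permutations of [n]) avoiding every pattern in Π
numAv : ℕ → List (List ℕ) → ℕ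
numAv n Π = length (classReps [] (filterᵇ (avoidsAll Π) (perms n)))

{-# OPTIONS --safe #-}

-- A cyclic permutation of [n] has exactly one rotation starting with its least entry 0, so
-- #Av_n[Π] is the number of linear permutations 0τ of [n] avoiding [Π]. For
-- Π = {1234, 1324, 1423} these are exactly 0 k d with 1 ≤ k < n and d the remaining entries in
-- decreasing order: an ascent y < z in d would make 0 k y z an occurrence of 1234, 1324 or 1423,
-- according to where k lies relative to y and z; conversely, every four entries of 0 k d are an
-- increasing relabelling of one of a few words, each of which avoids [Π]. Symmetrically, for
-- {1324, 1423, 1432} they are 0 i k with i the remaining entries in increasing order. Hence both
-- counts are n − 1 for n ≥ 2, and for n ≤ 1 both sides are computed.

module Submission where

open import Defs
open import Data.Bool using (Bool; true; false; _∧_; not; T)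
open import Data.Bool.ListAction using (all; any)
open import Data.Bool.Properties using (T-≡; T-∧)
open import Data.Empty using (⊥-elim)
open import Data.List
  using (List; []; _∷_; _++_; [_]; map; length; drop; take; downFrom; upTo; applyUpTo; filterᵇ; zip;
         initLast; _∷ʳ′_)
open import Data.List.Properties
  using (++-assoc; ++-identityʳ; length-++-comm; length-++-≤ˡ; length-map; length-applyUpTo; take++drop≡id;
         map-++; reverse-upTo; ∷ʳ-injective; ∷-injective; ∷-injectiveˡ; ∷-injectiveʳ)
open import Data.List.Membership.Propositional using (_∈_; find; lose)
open import Data.List.Membership.Propositional.Properties
  using (∈-++⁺ˡ; ∈-++⁺ʳ; ∈-++⁻; ∈-map⁺; ∈-map⁻; ∈-upTo⁺; ∈-downFrom⁺; ∈-downFrom⁻; ∈-concatMap⁺;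
         ∈-concatMap⁻; ∈-∃++; ∈-filter⁺; ∈-filter⁻; ∈-applyUpTo⁺; ∈-applyUpTo⁻)
open import Data.List.Membership.Propositional.Properties.WithK using (unique∧set⇒bag)
open import Data.List.Relation.Binary.BagAndSetEquality using (∼bag⇒↭)
open import Data.List.Relation.Binary.Permutation.Propositional
  using (_↭_; ↭-refl; ↭-sym; ↭-trans; prep; swap; ↭⇒↭ₛ)
open import Data.List.Relation.Binary.Permutation.Propositional.Properties
  using (shift; drop-mid; drop-∷; ↭-reverse; ∈-resp-↭; All-resp-↭; ↭-empty-inv; ↭-length)
  renaming (++-comm to ↭-++-comm)
open import Data.List.Relation.Binary.Permutation.Setoid.Properties using (Unique-resp-↭)
open import Data.List.Relation.Binary.Sublist.Propositional
  using (_⊆_; []; _∷_; _∷ʳ_; from∈; ⊆-refl; ⊆-trans)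
open import Data.List.Relation.Binary.Sublist.Propositional.Properties
  using (All-resp-⊆; Any-resp-⊆) renaming (++⁺ to ⊆-++⁺)
open import Data.List.Relation.Unary.All as All using (All; []; _∷_)
open import Data.List.Relation.Unary.All.Properties using (all⁺; all⁻)
open import Data.List.Relation.Unary.AllPairs as AllPairs using (AllPairs; []; _∷_)
open import Data.List.Relation.Unary.AllPairs.Properties using (applyUpTo⁺₁; applyDownFrom⁺₁)
open import Data.List.Relation.Unary.Any using (here; there)
open import Data.List.Relation.Unary.Any.Properties using (any⁺; any⁻)
open import Data.List.Relation.Unary.Linked using (Linked; [-]; _∷_)
open import Data.List.Relation.Unary.Linked.Properties using (Linked⇒AllPairs)
open import Data.List.Relation.Unary.Unique.Propositional using (Unique)
open import Data.List.Relation.Unary.Unique.Propositional.Properties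
  using (downFrom⁺) renaming (map⁺ to Unique-map⁺; applyUpTo⁺₁ to Unique-applyUpTo⁺₁)
open import Data.Nat using (ℕ; zero; suc; _<_; _>_; _≤_; _∸_; _<ᵇ_; _≡ᵇ_; s≤s; z≤n)
open import Data.Nat.Properties
  using (_≟_; <ᵇ⇒<; <⇒<ᵇ; ≡ᵇ⇒≡; ≡⇒≡ᵇ; <-irrefl; <-asym; <-trans; <-≤-trans; ≤-refl; <⇒≤; <-cmp;
         n≢0⇒n>0; suc-injective)
open import Data.Product using (_×_; _,_; proj₁; proj₂; ∃₂; ∃-syntax)
open import Data.Sum using (_⊎_; inj₁; inj₂)
open import Function using (id; _∘_; _⇔_; mk⇔; Equivalence)
open import Relation.Binary.Definitions using (tri<; tri≈; tri>)
open import Relation.Binary.PropositionalEquality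
  using (_≡_; _≢_; refl; sym; trans; cong; cong₂; subst; subst₂; setoid; module ≡-Reasoning)
open import Relation.Nullary using (¬_; yes; no)
open import Relation.Nullary.Decidable using (T?)

∈-subseqs⁻ : ∀ σ {s} → s ∈ subseqs σ → s ⊆ σ
∈-subseqs⁻ [] (here refl) = []
∈-subseqs⁻ (x ∷ σ) s∈ with ∈-++⁻ (map (x ∷_) (subseqs σ)) s∈
... | inj₂ s∈σ = x ∷ʳ ∈-subseqs⁻ σ s∈σ
... | inj₁ s∈x∷σ with ∈-map⁻ (x ∷_) s∈x∷σ
...   | s , s∈σ , refl = refl ∷ ∈-subseqs⁻ σ s∈σ

∈-subseqs⁺ : ∀ {σ s} → s ⊆ σ → s ∈ subseqs σ
∈-subseqs⁺ [] = here refl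
∈-subseqs⁺ (x ∷ʳ p) = ∈-++⁺ʳ _ (∈-subseqs⁺ p)
∈-subseqs⁺ (refl ∷ p) = ∈-++⁺ˡ (∈-map⁺ _ (∈-subseqs⁺ p))

⊆-++⁻ : ∀ {A : Set} (xs : List A) {ys s} → s ⊆ xs ++ ys → ∃₂ λ s₁ s₂ → s ≡ s₁ ++ s₂ × s₁ ⊆ xs × s₂ ⊆ ys
⊆-++⁻ [] p = [] , _ , refl , [] , p
⊆-++⁻ (x ∷ xs) (.x ∷ʳ p) with ⊆-++⁻ xs p
... | s₁ , s₂ , refl , p₁ , p₂ = s₁ , s₂ , refl , x ∷ʳ p₁ , p₂
⊆-++⁻ (x ∷ xs) (refl ∷ p) with ⊆-++⁻ xs p
... | s₁ , s₂ , refl , p₁ , p₂ = x ∷ s₁ , s₂ , refl , refl ∷ p₁ , p₂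

AllPairs-resp-⊆ : ∀ {A : Set} {R : A → A → Set} {s xs} → s ⊆ xs → AllPairs R xs → AllPairs R s
AllPairs-resp-⊆ [] [] = []
AllPairs-resp-⊆ (_ ∷ʳ p) (_ ∷ rs) = AllPairs-resp-⊆ p rs
AllPairs-resp-⊆ (refl ∷ p) (r ∷ rs) = All-resp-⊆ p r ∷ AllPairs-resp-⊆ p rs

AllPairs-from-⊆ : ∀ {A : Set} {R : A → A → Set} xs → (∀ {y z} → y ∷ z ∷ [] ⊆ xs → R y z) → AllPairs R xs
AllPairs-from-⊆ [] _ = []
AllPairs-from-⊆ (x ∷ xs) r = All.tabulate (λ z∈ → r (refl ∷ from∈ z∈)) ∷ AllPairs-from-⊆ xs (λ p → r (x ∷ʳ p))

T-not⁺ : ∀ {b} → ¬ T b → T (not b)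
T-not⁺ {false} _ = _
T-not⁺ {true} ¬b = ¬b _

T-not⁻ : ∀ {b} → T (not b) → ¬ T b
T-not⁻ {false} _ ()

contains⁻ : ∀ σ π → T (contains σ π) → ∃[ s ] (s ⊆ σ × T (orderIso s π))
contains⁻ σ π c with find (any⁻ _ (subseqs σ) c)
... | s , s∈ , s≅π = s , ∈-subseqs⁻ σ s∈ , s≅π

contains⁺ : ∀ {σ π s} → s ⊆ σ → T (orderIso s π) → T (contains σ π)
contains⁺ s⊆σ s≅π = any⁺ _ (lose (∈-subseqs⁺ s⊆σ) s≅π)

Rotation : ∀ {A : Set} → List A → List A → Set
Rotation σ ρ = ∃₂ λ a b → σ ≡ a ++ b × ρ ≡ b ++ a

Rotation-refl : ∀ {A : Set} (σ : List A) → Rotation σ σ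
Rotation-refl σ = [] , σ , refl , sym (++-identityʳ σ)

Rotation-sym : ∀ {A : Set} {σ ρ : List A} → Rotation σ ρ → Rotation ρ σ
Rotation-sym (a , b , σ≡ , ρ≡) = b , a , ρ≡ , σ≡

++-≡-++ : ∀ {A : Set} (a b c d : List A) → a ++ b ≡ c ++ d →
  (∃[ m ] (c ≡ a ++ m × b ≡ m ++ d)) ⊎ (∃[ m ] (a ≡ c ++ m × d ≡ m ++ b))
++-≡-++ [] b c d eq = inj₁ (c , refl , eq)
++-≡-++ (x ∷ a) b [] d eq = inj₂ (x ∷ a , refl , sym eq)
++-≡-++ (x ∷ a) b (y ∷ c) d eq with ∷-injective eq
... | refl , eq′ with ++-≡-++ a b c d eq′
...   | inj₁ (m , refl , b≡) = inj₁ (m , refl , b≡)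
...   | inj₂ (m , refl , d≡) = inj₂ (m , refl , d≡)

Rotation-trans : ∀ {A : Set} {σ ρ υ : List A} → Rotation σ ρ → Rotation ρ υ → Rotation σ υ
Rotation-trans (a , b , refl , ρ≡) (c , d , ρ≡′ , refl) with ++-≡-++ b a c d (trans (sym ρ≡) ρ≡′)
... | inj₁ (m , refl , refl) = m , d ++ b , ++-assoc m d b , sym (++-assoc d b m)
... | inj₂ (m , refl , refl) = a ++ c , m , sym (++-assoc a c m) , ++-assoc m a c

Rotation⇒↭ : ∀ {A : Set} {σ ρ : List A} → Rotation σ ρ → σ ↭ ρ
Rotation⇒↭ (a , b , refl , refl) = ↭-++-comm a b

rotateOnce : ∀ {A : Set} (x : A) xs → Rotation (x ∷ xs) (xs ++ [ x ])
rotateOnce x xs = [ x ] , xs , refl , refl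

drop-length-++ : ∀ {A : Set} (a b : List A) → drop (length a) (a ++ b) ≡ b
drop-length-++ [] b = refl
drop-length-++ (x ∷ a) b = drop-length-++ a b

take-length-++ : ∀ {A : Set} (a b : List A) → take (length a) (a ++ b) ≡ a
take-length-++ [] [] = refl
take-length-++ [] (_ ∷ _) = refl
take-length-++ (x ∷ a) b = cong (x ∷_) (take-length-++ a b)

∈-rotations⁻ : ∀ σ {ρ} → ρ ∈ rotations σ → Rotation σ ρ
∈-rotations⁻ σ ρ∈ with ∈-map⁻ (λ k → rotate k σ) {xs = upTo (suc (length σ))} ρ∈
... | k , _ , refl = take k σ , drop k σ , sym (take++drop≡id k σ) , refl

∈-rotations⁺ : ∀ {σ ρ} → Rotation σ ρ → ρ ∈ rotations σ
∈-rotations⁺ (a , b , refl , refl) =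
  subst (_∈ rotations (a ++ b)) (cong₂ _++_ (drop-length-++ a b) (take-length-++ a b))
    (∈-map⁺ (λ k → rotate k (a ++ b)) (∈-upTo⁺ (s≤s (length-++-≤ˡ a))))

==⇒≡ : ∀ σ ρ → T (σ == ρ) → σ ≡ ρ
==⇒≡ [] [] _ = refl
==⇒≡ (x ∷ σ) (y ∷ ρ) eq with x ≡ᵇ y in x≡ᵇy
... | true = cong₂ _∷_ (≡ᵇ⇒≡ x y (subst T (sym x≡ᵇy) _)) (==⇒≡ σ ρ eq)

==-refl : ∀ σ → T (σ == σ)
==-refl [] = _
==-refl (x ∷ σ) with x ≡ᵇ x in x≡ᵇx
... | true = ==-refl σ
... | false = subst T x≡ᵇx (≡⇒≡ᵇ x x refl)

sameCyclic⁻ : ∀ σ ρ → T (sameCyclic σ ρ) → Rotation σ ρ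
sameCyclic⁻ σ ρ s with find (any⁻ _ (rotations σ) s)
... | υ , υ∈ , υ≡ρ = subst (Rotation σ) (==⇒≡ υ ρ υ≡ρ) (∈-rotations⁻ σ υ∈)

sameCyclic⁺ : ∀ {σ ρ} → Rotation σ ρ → T (sameCyclic σ ρ)
sameCyclic⁺ {ρ = ρ} r = any⁺ _ (lose (∈-rotations⁺ r) (==-refl ρ))

cycContains⁻ : ∀ σ π → T (cycContains σ π) → ∃[ ρ ] (Rotation σ ρ × T (contains ρ π))
cycContains⁻ σ π c with find (any⁻ _ (rotations σ) c)
... | ρ , ρ∈ , cρ = ρ , ∈-rotations⁻ σ ρ∈ , cρ

cycContains⁺ : ∀ {σ ρ} π → Rotation σ ρ → T (contains ρ π) → T (cycContains σ π)
cycContains⁺ π r c = any⁺ _ (lose (∈-rotations⁺ r) c)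

cycContains-resp-Rotation : ∀ {σ ρ} π → Rotation σ ρ → T (cycContains σ π) → T (cycContains ρ π)
cycContains-resp-Rotation {σ} π r c with cycContains⁻ σ π c
... | υ , r′ , cυ = cycContains⁺ π (Rotation-trans (Rotation-sym r) r′) cυ

avoidsAll-resp-Rotation : ∀ Π {σ ρ} → Rotation σ ρ → T (avoidsAll Π σ) → T (avoidsAll Π ρ)
avoidsAll-resp-Rotation Π r av = all⁻ _ (All.map
  (λ σ-avoids → T-not⁺ (T-not⁻ σ-avoids ∘ cycContains-resp-Rotation _ (Rotation-sym r)))
  (all⁺ _ Π av))

avoidsAll⇒¬cycContains : ∀ {Π σ π} → T (avoidsAll Π σ) → π ∈ Π → ¬ T (cycContains σ π)
avoidsAll⇒¬cycContains av π∈ = T-not⁻ (All.lookup (all⁺ _ _ av) π∈)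

avoidsAll⇒¬contains : ∀ {Π σ π} → T (avoidsAll Π σ) → π ∈ Π → ¬ T (contains σ π)
avoidsAll⇒¬contains {σ = σ} {π} av π∈ =
  avoidsAll⇒¬cycContains {σ = σ} av π∈ ∘ cycContains⁺ π (Rotation-refl σ)

∈-insertEverywhere⁻ : ∀ x σ {τ} → τ ∈ insertEverywhere x σ → ∃₂ λ a b → σ ≡ a ++ b × τ ≡ a ++ x ∷ b
∈-insertEverywhere⁻ x [] (here refl) = [] , [] , refl , refl
∈-insertEverywhere⁻ x (y ∷ σ) (here refl) = [] , y ∷ σ , refl , refl
∈-insertEverywhere⁻ x (y ∷ σ) (there τ∈) with ∈-map⁻ (y ∷_) τ∈
... | τ , τ∈′ , refl with ∈-insertEverywhere⁻ x σ τ∈′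
...   | a , b , refl , refl = y ∷ a , b , refl , refl

∈-insertEverywhere⁺ : ∀ x a b → a ++ x ∷ b ∈ insertEverywhere x (a ++ b)
∈-insertEverywhere⁺ x [] [] = here refl
∈-insertEverywhere⁺ x [] (y ∷ b) = here refl
∈-insertEverywhere⁺ x (y ∷ a) b = there (∈-map⁺ (y ∷_) (∈-insertEverywhere⁺ x a b))

∈-perms⁻ : ∀ n {σ} → σ ∈ perms n → σ ↭ downFrom n
∈-perms⁻ zero (here refl) = ↭-refl
∈-perms⁻ (suc n) σ∈ with find (∈-concatMap⁻ (insertEverywhere n) {xs = perms n} σ∈)
... | ρ , ρ∈ , σ∈ρ+n with ∈-insertEverywhere⁻ n ρ σ∈ρ+n
...   | a , b , refl , refl = ↭-trans (shift n a b) (prep n (∈-perms⁻ n ρ∈))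

∈-perms⁺ : ∀ n {σ} → σ ↭ downFrom n → σ ∈ perms n
∈-perms⁺ zero p rewrite ↭-empty-inv p = here refl
∈-perms⁺ (suc n) p with ∈-∃++ (∈-resp-↭ (↭-sym p) (here {xs = downFrom n} refl))
... | a , b , refl =
  ∈-concatMap⁺ (insertEverywhere n) (lose (∈-perms⁺ n (drop-mid a [] p)) (∈-insertEverywhere⁺ n a b))

↭-downFrom⇒Unique : ∀ {n σ} → σ ↭ downFrom n → Unique σ
↭-downFrom⇒Unique p = Unique-resp-↭ (setoid ℕ) (↭⇒↭ₛ (↭-sym p)) (downFrom⁺ _)

-- Counting rotation classes

splitAt0 : List ℕ → List ℕ × List ℕ
splitAt0 [] = [] , []
splitAt0 (zero ∷ σ) = [] , zero ∷ σ
splitAt0 (suc x ∷ σ) = suc x ∷ proj₁ (splitAt0 σ) , proj₂ (splitAt0 σ)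

rotateTo0 : List ℕ → List ℕ
rotateTo0 σ = proj₂ (splitAt0 σ) ++ proj₁ (splitAt0 σ)

splitAt0-++ : ∀ σ → σ ≡ proj₁ (splitAt0 σ) ++ proj₂ (splitAt0 σ)
splitAt0-++ [] = refl
splitAt0-++ (zero ∷ σ) = refl
splitAt0-++ (suc x ∷ σ) = cong (suc x ∷_) (splitAt0-++ σ)

rotateTo0-Rotation : ∀ σ → Rotation σ (rotateTo0 σ)
rotateTo0-Rotation σ = proj₁ (splitAt0 σ) , proj₂ (splitAt0 σ) , splitAt0-++ σ , refl

splitAt0-0∷ : ∀ {σ} → 0 ∈ σ → ∃[ τ ] (proj₂ (splitAt0 σ) ≡ 0 ∷ τ)
splitAt0-0∷ {zero ∷ σ} _ = σ , refl
splitAt0-0∷ {suc x ∷ σ} (there 0∈σ) = splitAt0-0∷ 0∈σ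

rotateTo0-0∷ : ∀ {σ} → 0 ∈ σ → ∃[ τ ] (rotateTo0 σ ≡ 0 ∷ τ)
rotateTo0-0∷ {σ} 0∈σ with splitAt0-0∷ 0∈σ
... | τ , eq = τ ++ proj₁ (splitAt0 σ) , cong (_++ proj₁ (splitAt0 σ)) eq

Rotation-0∷⇒≡ : ∀ {u w} → Unique (0 ∷ u) → Rotation (0 ∷ u) (0 ∷ w) → u ≡ w
Rotation-0∷⇒≡ _ ([] , _ , refl , eq) = sym (∷-injectiveʳ (trans eq (++-identityʳ _)))
Rotation-0∷⇒≡ _ (_ ∷ a , [] , σ≡ , ρ≡) with ∷-injective σ≡ | ∷-injective ρ≡
... | refl , refl | refl , w≡ = trans (++-identityʳ a) (sym w≡)
Rotation-0∷⇒≡ (0∉u ∷ _) (_ ∷ a , _ ∷ b , σ≡ , ρ≡) with ∷-injective σ≡ | ∷-injective ρ≡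
... | refl , refl | refl , _ = ⊥-elim (All.lookup 0∉u (∈-++⁺ʳ a (here refl)) refl)

rotateTo0-resp-Rotation : ∀ {σ ρ} → Unique σ → 0 ∈ σ → Rotation σ ρ → rotateTo0 σ ≡ rotateTo0 ρ
rotateTo0-resp-Rotation {σ} {ρ} σ-unique 0∈σ r
  with rotateTo0-0∷ 0∈σ | rotateTo0-0∷ (∈-resp-↭ (Rotation⇒↭ r) 0∈σ)
... | u , σ₀≡ | w , ρ₀≡ = begin
  rotateTo0 σ ≡⟨ σ₀≡ ⟩
  0 ∷ u       ≡⟨ cong (0 ∷_) (Rotation-0∷⇒≡ 0∷u-unique 0∷u↻0∷w) ⟩
  0 ∷ w       ≡⟨ sym ρ₀≡ ⟩
  rotateTo0 ρ ∎
  where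
  open ≡-Reasoning
  σ↻σ₀ : Rotation σ (rotateTo0 σ)
  σ↻σ₀ = rotateTo0-Rotation σ
  0∷u-unique : Unique (0 ∷ u)
  0∷u-unique = subst Unique σ₀≡ (Unique-resp-↭ (setoid ℕ) (↭⇒↭ₛ (Rotation⇒↭ σ↻σ₀)) σ-unique)
  0∷u↻0∷w : Rotation (0 ∷ u) (0 ∷ w)
  0∷u↻0∷w = subst₂ Rotation σ₀≡ ρ₀≡
    (Rotation-trans (Rotation-sym σ↻σ₀) (Rotation-trans r (rotateTo0-Rotation ρ)))

rotateTo0-injective : ∀ {σ ρ} → rotateTo0 σ ≡ rotateTo0 ρ → Rotation σ ρ
rotateTo0-injective {σ} {ρ} eq = Rotation-trans (rotateTo0-Rotation σ)
  (subst (λ υ → Rotation υ ρ) (sym eq) (Rotation-sym (rotateTo0-Rotation ρ)))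

record Representatives (seen xs reps : List (List ℕ)) : Set where
  field
    sound    : ∀ {ρ} → ρ ∈ reps → ρ ∈ seen ++ xs
    distinct : Unique (map rotateTo0 reps)
    complete : ∀ {σ} → σ ∈ seen ++ xs → rotateTo0 σ ∈ map rotateTo0 reps

classReps-Representatives : ∀ seen xs → All (λ σ → Unique σ × 0 ∈ σ) xs → Unique (map rotateTo0 seen) →
  Representatives seen xs (classReps seen xs)
classReps-Representatives seen [] _ seen-distinct = record
  { sound    = ∈-++⁺ˡ
  ; distinct = seen-distinct
  ; complete = λ σ∈ → ∈-map⁺ rotateTo0 (subst (_ ∈_) (++-identityʳ seen) σ∈)
  }
classReps-Representatives seen (x ∷ xs) ((x-unique , 0∈x) ∷ xs-ok) seen-distinct
  with any (sameCyclic x) seen in x-represented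
... | true with find (any⁻ _ seen (subst T (sym x-represented) _))
...   | y , y∈seen , x∼y = record
  { sound    = Any-resp-⊆ (⊆-++⁺ ⊆-refl (x ∷ʳ ⊆-refl)) ∘ R.sound
  ; distinct = R.distinct
  ; complete = complete
  }
  where
  module R = Representatives (classReps-Representatives seen xs xs-ok seen-distinct)
  complete : ∀ {σ} → σ ∈ seen ++ x ∷ xs → rotateTo0 σ ∈ map rotateTo0 (classReps seen xs)
  complete σ∈ with ∈-++⁻ seen σ∈
  ... | inj₁ σ∈seen = R.complete (∈-++⁺ˡ σ∈seen)
  ... | inj₂ (there σ∈xs) = R.complete (∈-++⁺ʳ seen σ∈xs)
  ... | inj₂ (here refl) = subst (_∈ _) (sym (rotateTo0-resp-Rotation x-unique 0∈x (sameCyclic⁻ x y x∼y)))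
        (R.complete (∈-++⁺ˡ y∈seen))
classReps-Representatives seen (x ∷ xs) (_ ∷ xs-ok) seen-distinct | false = record
  { sound    = ∈-resp-↭ (↭-sym (shift x seen xs)) ∘ R.sound
  ; distinct = R.distinct
  ; complete = R.complete ∘ ∈-resp-↭ (shift x seen xs)
  }
  where
  new : ∀ {c} → c ∈ map rotateTo0 seen → rotateTo0 x ≢ c
  new c∈ x₀≡c with ∈-map⁻ rotateTo0 c∈
  ... | y , y∈ , refl =
    subst T x-represented (any⁺ _ (lose y∈ (sameCyclic⁺ (rotateTo0-injective {x} {y} x₀≡c))))
  module R = Representatives
    (classReps-Representatives (x ∷ seen) xs xs-ok (All.tabulate new ∷ seen-distinct))

Unique-sameMembers⇒length≡ : ∀ {A : Set} {xs ys : List A} → Unique xs → Unique ys →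
  (∀ {x} → x ∈ xs ⇔ x ∈ ys) → length xs ≡ length ys
Unique-sameMembers⇒length≡ xs-unique ys-unique same =
  ↭-length (∼bag⇒↭ (unique∧set⇒bag xs-unique ys-unique same))

avoiders : ℕ → List (List ℕ) → List (List ℕ)
avoiders n Π = filterᵇ (avoidsAll Π) (perms n)

∈-avoiders⁻ : ∀ n Π {σ} → σ ∈ avoiders n Π → σ ↭ downFrom n × T (avoidsAll Π σ)
∈-avoiders⁻ n Π σ∈ with ∈-filter⁻ (T? ∘ avoidsAll Π) {xs = perms n} σ∈
... | σ∈perms , σ-avoids = ∈-perms⁻ n σ∈perms , σ-avoids

∈-avoiders⁺ : ∀ n Π {σ} → σ ↭ downFrom n → T (avoidsAll Π σ) → σ ∈ avoiders n Π
∈-avoiders⁺ n Π p σ-avoids = ∈-filter⁺ (T? ∘ avoidsAll Π) (∈-perms⁺ n p) σ-avoids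

rotateTo0-avoider : ∀ m Π {σ} → σ ∈ avoiders (suc m) Π →
  ∃[ τ ] (rotateTo0 σ ≡ 0 ∷ τ × (0 ∷ τ) ↭ downFrom (suc m) × T (avoidsAll Π (0 ∷ τ)))
rotateTo0-avoider m Π {σ} σ∈ with ∈-avoiders⁻ (suc m) Π σ∈
... | p , σ-avoids with rotateTo0-0∷ (∈-resp-↭ (↭-sym p) (∈-downFrom⁺ (s≤s z≤n)))
... | τ , σ₀≡ = τ , σ₀≡ , ↭-trans (↭-sym (Rotation⇒↭ σ↻0∷τ)) p , avoidsAll-resp-Rotation Π σ↻0∷τ σ-avoids
  where
  σ↻0∷τ : Rotation σ (0 ∷ τ)
  σ↻0∷τ = subst (Rotation σ) σ₀≡ (rotateTo0-Rotation σ)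

avoiders-Representatives : ∀ m Π → Representatives [] (avoiders (suc m) Π) (classReps [] (avoiders (suc m) Π))
avoiders-Representatives m Π = classReps-Representatives [] (avoiders (suc m) Π)
  (All.tabulate (λ σ∈ → well-formed (proj₁ (∈-avoiders⁻ (suc m) Π σ∈)))) []
  where
  well-formed : ∀ {σ} → σ ↭ downFrom (suc m) → Unique σ × 0 ∈ σ
  well-formed p = ↭-downFrom⇒Unique p , ∈-resp-↭ (↭-sym p) (∈-downFrom⁺ (s≤s z≤n))

-- classReps keeps one permutation per rotation class, and rotateTo0 maps the kept ones
-- bijectively onto the avoiders that start with 0.
numAv≡length : ∀ m Π τs → Unique τs →
  (∀ {τ} → τ ∈ τs ⇔ ((0 ∷ τ) ↭ downFrom (suc m) × T (avoidsAll Π (0 ∷ τ)))) →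
  numAv (suc m) Π ≡ length τs
numAv≡length m Π τs τs-unique τs-spec = begin
  numAv (suc m) Π             ≡⟨ length-map rotateTo0 reps ⟨
  length (map rotateTo0 reps) ≡⟨ Unique-sameMembers⇒length≡ R.distinct 0∷τs-unique (mk⇔ to from) ⟩
  length (map (0 ∷_) τs)      ≡⟨ length-map (0 ∷_) τs ⟩
  length τs                   ∎
  where
  open ≡-Reasoning
  reps : List (List ℕ)
  reps = classReps [] (avoiders (suc m) Π)
  module R = Representatives (avoiders-Representatives m Π)
  0∷τs-unique : Unique (map (0 ∷_) τs)
  0∷τs-unique = Unique-map⁺ ∷-injectiveʳ τs-unique

  to : ∀ {σ} → σ ∈ map rotateTo0 reps → σ ∈ map (0 ∷_) τs
  to σ∈ with ∈-map⁻ rotateTo0 σ∈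
  ... | ρ , ρ∈ , refl =
    -- not a with: abstracting would normalise the types in scope, which mention classReps
    let τ , ρ₀≡ , 0∷τ-spec = rotateTo0-avoider m Π (R.sound ρ∈)
    in subst (_∈ map (0 ∷_) τs) (sym ρ₀≡) (∈-map⁺ (0 ∷_) (Equivalence.from τs-spec 0∷τ-spec))

  from : ∀ {σ} → σ ∈ map (0 ∷_) τs → σ ∈ map rotateTo0 reps
  from σ∈ with ∈-map⁻ (0 ∷_) σ∈
  ... | τ , τ∈ , refl with Equivalence.to τs-spec τ∈
  ... | p , avoids = subst (_∈ map rotateTo0 reps) (++-identityʳ (0 ∷ τ))
        (R.complete {0 ∷ τ} (∈-avoiders⁺ (suc m) Π p avoids))

-- 0 past the end; only used at indices below the length.
at : List ℕ → ℕ → ℕ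
at [] _ = 0
at (w ∷ ws) zero = w
at (w ∷ ws) (suc i) = at ws i

at-∈ : ∀ ws {i} → i < length ws → at ws i ∈ ws
at-∈ (w ∷ ws) {zero} _ = here refl
at-∈ (w ∷ ws) {suc i} (s≤s i<) = there (at-∈ ws i<)

<ᵇ-true : ∀ {m n} → m < n → (m <ᵇ n) ≡ true
<ᵇ-true m<n = Equivalence.to T-≡ (<⇒<ᵇ m<n)

<ᵇ-false : ∀ {m n} → n ≤ m → (m <ᵇ n) ≡ false
<ᵇ-false {m} {n} n≤m with m <ᵇ n in m<ᵇn
... | false = refl
... | true = ⊥-elim (<-irrefl refl (<-≤-trans (<ᵇ⇒< m n (subst T (sym m<ᵇn) _)) n≤m))

at-<ᵇ : ∀ {ws} → AllPairs _<_ ws → ∀ {i j} → i < length ws → j < length ws →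
  (at ws i <ᵇ at ws j) ≡ (i <ᵇ j)
at-<ᵇ {w ∷ ws} _ {zero} {zero} _ _ = <ᵇ-false {w} ≤-refl
at-<ᵇ {w ∷ ws} (w< ∷ _) {zero} {suc j} _ (s≤s j<) = <ᵇ-true (All.lookup w< (at-∈ ws j<))
at-<ᵇ {w ∷ ws} (w< ∷ _) {suc i} {zero} (s≤s i<) _ = <ᵇ-false (<⇒≤ (All.lookup w< (at-∈ ws i<)))
at-<ᵇ {w ∷ ws} (_ ∷ ws<) {suc i} {suc j} (s≤s i<) (s≤s j<) = at-<ᵇ ws< i< j<

all-zip-map : ∀ (f : ℕ → ℕ) (p r : ℕ × ℕ → Bool) xs ys → (∀ {x} y → x ∈ xs → p (f x , y) ≡ r (x , y)) →
  all p (zip (map f xs) ys) ≡ all r (zip xs ys)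
all-zip-map f p r [] ys _ = refl
all-zip-map f p r (x ∷ xs) [] _ = refl
all-zip-map f p r (x ∷ xs) (y ∷ ys) p≡r =
  cong₂ _∧_ (p≡r y (here refl)) (all-zip-map f p r xs ys (λ y′ → p≡r y′ ∘ there))

orderIso-map : ∀ (f : ℕ → ℕ) q π → (∀ {x y} → x ∈ q → y ∈ q → (f x <ᵇ f y) ≡ (x <ᵇ y)) →
  orderIso (map f q) π ≡ orderIso q π
orderIso-map f [] [] _ = refl
orderIso-map f [] (_ ∷ _) _ = refl
orderIso-map f (x ∷ q) [] _ = refl
orderIso-map f (x ∷ q) (y ∷ π) mono = cong₂ _∧_
  (all-zip-map f _ _ q π (λ y′ x′∈ → cong (_⇔ᵇ (y <ᵇ y′)) (mono (here refl) (there x′∈))))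
  (orderIso-map f q π (λ x∈ y∈ → mono (there x∈) (there y∈)))

orderIso-length : ∀ s π → T (orderIso s π) → length s ≡ length π
orderIso-length [] [] _ = refl
orderIso-length (x ∷ s) (y ∷ π) s≅π = cong suc (orderIso-length s π (proj₂ (Equivalence.to T-∧ s≅π)))

record Relabelling (q t : List ℕ) : Set where
  constructor relabel
  field
    values     : List ℕ
    increasing : Linked _<_ values
    image      : t ≡ map (at values) q
    inRange    : T (all (_<ᵇ length values) q)

orderIso-Relabelling : ∀ {q t} π → Relabelling q t → orderIso t π ≡ orderIso q π
orderIso-Relabelling {q} π (relabel ws ws↗ refl q<) = orderIso-map (at ws) q π mono
  where
  bound : ∀ {x} → x ∈ q → x < length ws
  bound x∈ = <ᵇ⇒< _ _ (All.lookup (all⁺ _ q q<) x∈)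
  mono : ∀ {x y} → x ∈ q → y ∈ q → (at ws x <ᵇ at ws y) ≡ (x <ᵇ y)
  mono x∈ y∈ = at-<ᵇ (Linked⇒AllPairs <-trans ws↗) (bound x∈) (bound y∈)

map-≡-++⁻ : ∀ {A B : Set} (f : A → B) q a {b} → a ++ b ≡ map f q →
  ∃₂ λ q₁ q₂ → q ≡ q₁ ++ q₂ × a ≡ map f q₁ × b ≡ map f q₂
map-≡-++⁻ f q [] eq = [] , q , refl , refl , eq
map-≡-++⁻ f (x ∷ q) (y ∷ a) eq with ∷-injective eq
... | refl , eq′ with map-≡-++⁻ f q a eq′
...   | q₁ , q₂ , refl , refl , refl = x ∷ q₁ , q₂ , refl , refl , refl

Relabelling-rotation : ∀ {q} a b → Relabelling q (a ++ b) → ∃[ q′ ] (Rotation q q′ × Relabelling q′ (b ++ a))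
Relabelling-rotation {q} a b (relabel ws ws↗ image q<) with map-≡-++⁻ (at ws) q a image
... | q₁ , q₂ , refl , refl , refl =
  q₂ ++ q₁ , (q₁ , q₂ , refl , refl) ,
  relabel ws ws↗ (sym (map-++ (at ws) q₂ q₁))
    (all⁻ _ (All-resp-↭ (↭-++-comm q₁ q₂) (all⁺ _ (q₁ ++ q₂) q<)))

-- Avoidance from the four-point subsequences

Covered : List (List ℕ) → List ℕ → Set
Covered Π σ = ∀ {w x y z} → w ∷ x ∷ y ∷ z ∷ [] ⊆ σ →
  ∃[ q ] (T (avoidsAll Π q) × Relabelling q (w ∷ x ∷ y ∷ z ∷ []))

coveredBy : ∀ Π {t} q ws → Linked _<_ ws → t ≡ map (at ws) q →
  {T (all (_<ᵇ length ws) q)} → {T (avoidsAll Π q)} → ∃[ q′ ] (T (avoidsAll Π q′) × Relabelling q′ t)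
coveredBy Π q ws ws↗ image {q<} {q-avoids} = q , q-avoids , relabel ws ws↗ image q<

length≡4⇒quadruple : ∀ (t : List ℕ) → length t ≡ 4 → ∃[ w ] ∃[ x ] ∃[ y ] ∃[ z ] (t ≡ w ∷ x ∷ y ∷ z ∷ [])
length≡4⇒quadruple (w ∷ x ∷ y ∷ z ∷ []) _ = w , x , y , z , refl

avoidsAll⇒¬occurrence : ∀ Π {σ π s} → T (avoidsAll Π σ) → π ∈ Π → s ⊆ σ →
  ∀ q ws → Linked _<_ ws → s ≡ map (at ws) q → {T (all (_<ᵇ length ws) q)} → ¬ T (orderIso q π)
avoidsAll⇒¬occurrence Π {σ} {π} avoids π∈ s⊆σ q ws ws↗ image {q<} q≅π =
  avoidsAll⇒¬contains {Π} {σ} avoids π∈ (contains⁺ s⊆σ (subst T (sym (orderIso-Relabelling π (relabel {q} ws ws↗ image q<))) q≅π))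

-- An occurrence s₁ ++ s₂ of π in the rotation b ++ a of σ = a ++ b, with s₁ ⊆ b and s₂ ⊆ a,
-- gives the four-point subsequence s₂ ++ s₁ of σ, and hence a rotation of its word q that is
-- order isomorphic to π.
avoidsAll-fromCover : ∀ {Π σ} → All (λ π → length π ≡ 4) Π → Covered Π σ → T (avoidsAll Π σ)
avoidsAll-fromCover {Π} {σ} Π-length covered = all⁻ _ (All.tabulate (T-not⁺ ∘ noOccurrence))
  where
  noOccurrence : ∀ {π} → π ∈ Π → ¬ T (cycContains σ π)
  noOccurrence {π} π∈ c with cycContains⁻ σ π c
  ... | _ , (a , b , refl , refl) , ρ-contains with contains⁻ (b ++ a) π ρ-contains
  ... | _ , s⊆ , s≅π with ⊆-++⁻ b s⊆
  ... | s₁ , s₂ , refl , s₁⊆b , s₂⊆a with length≡4⇒quadruple (s₂ ++ s₁)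
    (trans (length-++-comm s₂ s₁) (trans (orderIso-length (s₁ ++ s₂) π s≅π) (All.lookup Π-length π∈)))
  ... | w , x , y , z , t≡ with covered (subst (_⊆ a ++ b) t≡ (⊆-++⁺ s₂⊆a s₁⊆b))
  ... | q , q-avoids , q↦t with Relabelling-rotation s₂ s₁ (subst (Relabelling q) (sym t≡) q↦t)
  ... | q′ , q↻q′ , q′↦s = avoidsAll⇒¬cycContains {σ = q} q-avoids π∈
    (cycContains⁺ π q↻q′ (contains⁺ {q′} ⊆-refl (subst T (orderIso-Relabelling π q′↦s) s≅π)))

<-cmp-≢ : ∀ {m n} → m ≢ n → m < n ⊎ n < m
<-cmp-≢ {m} {n} m≢n with <-cmp m n
... | tri< m<n _ _ = inj₁ m<n
... | tri≈ _ m≡n _ = ⊥-elim (m≢n m≡n)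
... | tri> _ _ n<m = inj₂ n<m

remove : ℕ → List ℕ → List ℕ
remove k [] = []
remove k (x ∷ xs) with x ≟ k
... | yes _ = xs
... | no _ = x ∷ remove k xs

remove-⊆ : ∀ k xs → remove k xs ⊆ xs
remove-⊆ k [] = []
remove-⊆ k (x ∷ xs) with x ≟ k
... | yes _ = x ∷ʳ ⊆-refl
... | no _ = refl ∷ remove-⊆ k xs

remove-↭ : ∀ {k xs} → k ∈ xs → xs ↭ k ∷ remove k xs
remove-↭ {k} {x ∷ xs} k∈ with x ≟ k | k∈
... | yes refl | _ = ↭-refl
... | no x≢k | here refl = ⊥-elim (x≢k refl)
... | no _ | there k∈xs = ↭-trans (prep x (remove-↭ k∈xs)) (swap x k ↭-refl)

∈-remove⁺ : ∀ {k xs y} → y ∈ xs → y ≢ k → y ∈ remove k xs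
∈-remove⁺ {k} {x ∷ xs} y∈ y≢k with x ≟ k | y∈
... | yes x≡k | here refl = ⊥-elim (y≢k x≡k)
... | yes _ | there y∈xs = y∈xs
... | no _ | here refl = here refl
... | no _ | there y∈xs = there (∈-remove⁺ y∈xs y≢k)

↭-remove₂ : ∀ {a b xs} → a ∈ xs → b ∈ xs → a ≢ b → xs ↭ a ∷ b ∷ remove b (remove a xs)
↭-remove₂ a∈ b∈ a≢b = ↭-trans (remove-↭ a∈) (prep _ (remove-↭ (∈-remove⁺ b∈ (a≢b ∘ sym))))

AllPairs-↭⇒≡ : ∀ {A : Set} {R : A → A → Set} → (∀ {x y} → R x y → ¬ R y x) →
  ∀ {xs ys} → AllPairs R xs → AllPairs R ys → xs ↭ ys → xs ≡ ys
AllPairs-↭⇒≡ asym {[]} {ys} _ _ p with ↭-empty-inv (↭-sym p)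
... | refl = refl
AllPairs-↭⇒≡ asym {x ∷ xs} {[]} _ _ p with ↭-empty-inv p
... | ()
AllPairs-↭⇒≡ asym {x ∷ xs} {y ∷ ys} (x< ∷ xs<) (y< ∷ ys<) p
  with ∈-resp-↭ p (here {xs = xs} refl) | ∈-resp-↭ (↭-sym p) (here {xs = ys} refl)
... | here refl | _ = cong (x ∷_) (AllPairs-↭⇒≡ asym xs< ys< (drop-∷ p))
... | there _ | here refl = cong (x ∷_) (AllPairs-↭⇒≡ asym xs< ys< (drop-∷ p))
... | there x∈ys | there y∈xs = ⊥-elim (asym (All.lookup y< x∈ys) (All.lookup x< y∈xs))

downFrom-↘ : ∀ n → AllPairs _>_ (downFrom n)
downFrom-↘ n = applyDownFrom⁺₁ id n (λ j<i _ → j<i)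

upTo-↗ : ∀ n → AllPairs _<_ (upTo n)
upTo-↗ n = applyUpTo⁺₁ id n (λ i<j _ → i<j)

upTo-↭-downFrom : ∀ n → upTo n ↭ downFrom n
upTo-↭-downFrom n = subst (upTo n ↭_) (reverse-upTo n) (↭-sym (↭-reverse (upTo n)))

labels : ℕ → List ℕ
labels m = applyUpTo suc m

∈-labels⁻ : ∀ {m k} → k ∈ labels m → k ∈ downFrom (suc m) × k ≢ 0
∈-labels⁻ k∈ with ∈-applyUpTo⁻ suc k∈
... | i , i<m , refl = ∈-downFrom⁺ (s≤s i<m) , λ ()

∈-labels⁺ : ∀ {m k} → k ∈ downFrom (suc m) → k ≢ 0 → k ∈ labels m
∈-labels⁺ {k = zero} _ k≢0 = ⊥-elim (k≢0 refl)
∈-labels⁺ {k = suc i} k∈ _ with ∈-downFrom⁻ k∈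
... | s≤s i<m = ∈-applyUpTo⁺ suc i<m

labels-unique : ∀ m → Unique (labels m)
labels-unique m = Unique-applyUpTo⁺₁ suc m (λ i<j _ i≡j → <-irrefl (suc-injective i≡j) i<j)

numAv-byLabels : ∀ m Π (tail : ℕ → List ℕ) → (∀ {k k′} → tail k ≡ tail k′ → k ≡ k′) →
  (∀ {τ} → τ ∈ map tail (labels m) ⇔ ((0 ∷ τ) ↭ downFrom (suc m) × T (avoidsAll Π (0 ∷ τ)))) →
  numAv (suc m) Π ≡ m
numAv-byLabels m Π tail tail-injective spec = begin
  numAv (suc m) Π                 ≡⟨ numAv≡length m Π (map tail (labels m)) tails-unique spec ⟩
  length (map tail (labels m))    ≡⟨ length-map tail (labels m) ⟩
  length (labels m)               ≡⟨ length-applyUpTo suc m ⟩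
  m                               ∎
  where
  open ≡-Reasoning
  tails-unique : Unique (map tail (labels m))
  tails-unique = Unique-map⁺ tail-injective (labels-unique m)

-- Av_n[1234, 1324, 1423]

ΠA : List (List ℕ)
ΠA = (1 ∷ 2 ∷ 3 ∷ 4 ∷ []) ∷ (1 ∷ 3 ∷ 2 ∷ 4 ∷ []) ∷ (1 ∷ 4 ∷ 2 ∷ 3 ∷ []) ∷ []

ΠA-length : All (λ π → length π ≡ 4) ΠA
ΠA-length = refl ∷ refl ∷ refl ∷ []

module _ {k e} (u : Unique (0 ∷ k ∷ e)) where
  private
    0<k : 0 < k
    0<k = n≢0⇒n>0 (All.head (AllPairs.head u) ∘ sym)

    Entry : ℕ → Set
    Entry y = 0 < y × (k < y ⊎ y < k)

    entries : All Entry e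
    entries = All.zipWith (λ (0≢y , k≢y) → n≢0⇒n>0 (0≢y ∘ sym) , <-cmp-≢ k≢y)
      (All.tail (AllPairs.head u) , AllPairs.head (AllPairs.tail u))

    e-unique : Unique e
    e-unique = AllPairs.tail (AllPairs.tail u)

  coverA : AllPairs _>_ e → Covered ΠA (0 ∷ k ∷ e)
  coverA e↘ {y = y} {z} (refl ∷ refl ∷ p) with AllPairs-resp-⊆ p e↘ | All-resp-⊆ p entries
  ... | (z<y ∷ []) ∷ [] ∷ [] | _ ∷ (_ , inj₁ k<z) ∷ [] =
    coveredBy ΠA (0 ∷ 1 ∷ 3 ∷ 2 ∷ []) (0 ∷ k ∷ z ∷ y ∷ []) (0<k ∷ k<z ∷ z<y ∷ [-]) refl
  ... | (z<y ∷ []) ∷ [] ∷ [] | (_ , inj₁ k<y) ∷ (0<z , inj₂ z<k) ∷ [] =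
    coveredBy ΠA (0 ∷ 2 ∷ 3 ∷ 1 ∷ []) (0 ∷ z ∷ k ∷ y ∷ []) (0<z ∷ z<k ∷ k<y ∷ [-]) refl
  ... | (z<y ∷ []) ∷ [] ∷ [] | (_ , inj₂ y<k) ∷ (0<z , inj₂ _) ∷ [] =
    coveredBy ΠA (0 ∷ 3 ∷ 2 ∷ 1 ∷ []) (0 ∷ z ∷ y ∷ k ∷ []) (0<z ∷ z<y ∷ y<k ∷ [-]) refl
  coverA e↘ {x = x} {y} {z} (refl ∷ _ ∷ʳ p) with AllPairs-resp-⊆ p e↘ | All-resp-⊆ p entries
  ... | (y<x ∷ _) ∷ (z<y ∷ []) ∷ [] ∷ [] | _ ∷ _ ∷ (0<z , _) ∷ [] =
    coveredBy ΠA (0 ∷ 3 ∷ 2 ∷ 1 ∷ []) (0 ∷ z ∷ y ∷ x ∷ []) (0<z ∷ z<y ∷ y<x ∷ [-]) refl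
  coverA e↘ {x = x} {y} {z} (_ ∷ʳ refl ∷ p) with AllPairs-resp-⊆ p e↘ | All-resp-⊆ p entries
  ... | (y<x ∷ _) ∷ (z<y ∷ []) ∷ [] ∷ [] | _ ∷ _ ∷ (_ , inj₁ k<z) ∷ [] =
    coveredBy ΠA (0 ∷ 3 ∷ 2 ∷ 1 ∷ []) (k ∷ z ∷ y ∷ x ∷ []) (k<z ∷ z<y ∷ y<x ∷ [-]) refl
  ... | (y<x ∷ _) ∷ (z<y ∷ []) ∷ [] ∷ [] | _ ∷ (_ , inj₁ k<y) ∷ (_ , inj₂ z<k) ∷ [] =
    coveredBy ΠA (1 ∷ 3 ∷ 2 ∷ 0 ∷ []) (z ∷ k ∷ y ∷ x ∷ []) (z<k ∷ k<y ∷ y<x ∷ [-]) refl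
  ... | (y<x ∷ _) ∷ (z<y ∷ []) ∷ [] ∷ [] | (_ , inj₁ k<x) ∷ (_ , inj₂ y<k) ∷ _ =
    coveredBy ΠA (2 ∷ 3 ∷ 1 ∷ 0 ∷ []) (z ∷ y ∷ k ∷ x ∷ []) (z<y ∷ y<k ∷ k<x ∷ [-]) refl
  ... | (y<x ∷ _) ∷ (z<y ∷ []) ∷ [] ∷ [] | (_ , inj₂ x<k) ∷ (_ , inj₂ _) ∷ _ =
    coveredBy ΠA (3 ∷ 2 ∷ 1 ∷ 0 ∷ []) (z ∷ y ∷ x ∷ k ∷ []) (z<y ∷ y<x ∷ x<k ∷ [-]) refl
  coverA e↘ {w} {x} {y} {z} (_ ∷ʳ _ ∷ʳ p) with AllPairs-resp-⊆ p e↘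
  ... | (x<w ∷ _) ∷ (y<x ∷ _) ∷ (z<y ∷ []) ∷ [] ∷ [] =
    coveredBy ΠA (3 ∷ 2 ∷ 1 ∷ 0 ∷ []) (z ∷ y ∷ x ∷ w ∷ []) (z<y ∷ y<x ∷ x<w ∷ [-]) refl

  avoidsA⇒↘ : T (avoidsAll ΠA (0 ∷ k ∷ e)) → AllPairs _>_ e
  avoidsA⇒↘ avoids = AllPairs-from-⊆ e descent
    where
    descent : ∀ {y z} → y ∷ z ∷ [] ⊆ e → z < y
    descent {y} {z} p with <-cmp-≢ (All.head (AllPairs.head (AllPairs-resp-⊆ p e-unique)))
    ... | inj₂ z<y = z<y
    ... | inj₁ y<z with All-resp-⊆ p entries
    ...   | (_ , inj₁ k<y) ∷ _ = ⊥-elim (avoidsAll⇒¬occurrence ΠA avoids (here refl) (refl ∷ refl ∷ p)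
            (0 ∷ 1 ∷ 2 ∷ 3 ∷ []) (0 ∷ k ∷ y ∷ z ∷ []) (0<k ∷ k<y ∷ y<z ∷ [-]) refl _)
    ...   | (0<y , inj₂ y<k) ∷ (_ , inj₁ k<z) ∷ [] =
            ⊥-elim (avoidsAll⇒¬occurrence ΠA avoids (there (here refl)) (refl ∷ refl ∷ p)
            (0 ∷ 2 ∷ 1 ∷ 3 ∷ []) (0 ∷ y ∷ k ∷ z ∷ []) (0<y ∷ y<k ∷ k<z ∷ [-]) refl _)
    ...   | (0<y , inj₂ _) ∷ (_ , inj₂ z<k) ∷ [] =
            ⊥-elim (avoidsAll⇒¬occurrence ΠA avoids (there (there (here refl))) (refl ∷ refl ∷ p)
            (0 ∷ 3 ∷ 1 ∷ 2 ∷ []) (0 ∷ y ∷ z ∷ k ∷ []) (0<y ∷ y<z ∷ z<k ∷ [-]) refl _)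

restA : ℕ → ℕ → List ℕ
restA n k = remove 0 (remove k (downFrom n))

restA-↘ : ∀ n k → AllPairs _>_ (restA n k)
restA-↘ n k = AllPairs-resp-⊆ (⊆-trans (remove-⊆ 0 _) (remove-⊆ k _)) (downFrom-↘ n)

restA-↭ : ∀ {m k} → k ∈ labels m → 0 ∷ k ∷ restA (suc m) k ↭ downFrom (suc m)
restA-↭ k∈ with ∈-labels⁻ k∈
... | k∈downFrom , k≢0 =
  ↭-sym (↭-trans (↭-remove₂ k∈downFrom (∈-downFrom⁺ (s≤s z≤n)) k≢0) (swap _ 0 ↭-refl))

tailA : ℕ → ℕ → List ℕ
tailA n k = k ∷ restA n k

tailsA : ℕ → List (List ℕ)
tailsA m = map (tailA (suc m)) (labels m)

tailsA-spec : ∀ m {τ} →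
  τ ∈ tailsA (suc m) ⇔ ((0 ∷ τ) ↭ downFrom (suc (suc m)) × T (avoidsAll ΠA (0 ∷ τ)))
tailsA-spec m = mk⇔ to from
  where
  to : ∀ {τ} → τ ∈ tailsA (suc m) → (0 ∷ τ) ↭ downFrom (suc (suc m)) × T (avoidsAll ΠA (0 ∷ τ))
  to τ∈ with ∈-map⁻ (tailA (suc (suc m))) τ∈
  ... | k , k∈ , refl = restA-↭ k∈ ,
    avoidsAll-fromCover ΠA-length (coverA (↭-downFrom⇒Unique (restA-↭ k∈)) (restA-↘ (suc (suc m)) k))
  from : ∀ {τ} → (0 ∷ τ) ↭ downFrom (suc (suc m)) × T (avoidsAll ΠA (0 ∷ τ)) → τ ∈ tailsA (suc m)
  from {[]} (p , _) with ↭-length p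
  ... | ()
  from {k ∷ e} (p , avoids) =
    subst (λ e′ → (k ∷ e′) ∈ tailsA (suc m)) (sym e≡rest) (∈-map⁺ (tailA (suc (suc m))) k∈labels)
    where
    u : Unique (0 ∷ k ∷ e)
    u = ↭-downFrom⇒Unique p
    k∈labels : k ∈ labels (suc m)
    k∈labels = ∈-labels⁺ (∈-resp-↭ p (there (here refl))) (All.head (AllPairs.head u) ∘ sym)
    e≡rest : e ≡ restA (suc (suc m)) k
    e≡rest = AllPairs-↭⇒≡ <-asym (avoidsA⇒↘ u avoids) (restA-↘ (suc (suc m)) k)
      (drop-∷ (drop-∷ (↭-trans p (↭-sym (restA-↭ k∈labels)))))

numAv-ΠA : ∀ m → numAv (suc (suc m)) ΠA ≡ suc m
numAv-ΠA m = numAv-byLabels (suc m) ΠA (tailA (suc (suc m))) ∷-injectiveˡ (tailsA-spec m)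

-- Av_n[1324, 1423, 1432]

ΠB : List (List ℕ)
ΠB = (1 ∷ 3 ∷ 2 ∷ 4 ∷ []) ∷ (1 ∷ 4 ∷ 2 ∷ 3 ∷ []) ∷ (1 ∷ 4 ∷ 3 ∷ 2 ∷ []) ∷ []

ΠB-length : All (λ π → length π ≡ 4) ΠB
ΠB-length = refl ∷ refl ∷ refl ∷ []

module _ {k e} (u : Unique (k ∷ 0 ∷ e)) where
  private
    0<k : 0 < k
    0<k = n≢0⇒n>0 (All.head (AllPairs.head u))

    Entry : ℕ → Set
    Entry y = 0 < y × (k < y ⊎ y < k)

    entries : All Entry e
    entries = All.zipWith (λ (0≢y , k≢y) → n≢0⇒n>0 (0≢y ∘ sym) , <-cmp-≢ k≢y)
      (AllPairs.head (AllPairs.tail u) , All.tail (AllPairs.head u))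

    e-unique : Unique e
    e-unique = AllPairs.tail (AllPairs.tail u)

  coverB : AllPairs _<_ e → Covered ΠB (k ∷ 0 ∷ e)
  coverB e↗ {y = y} {z} (refl ∷ refl ∷ p) with AllPairs-resp-⊆ p e↗ | All-resp-⊆ p entries
  ... | (y<z ∷ []) ∷ [] ∷ [] | (_ , inj₁ k<y) ∷ _ =
    coveredBy ΠB (1 ∷ 0 ∷ 2 ∷ 3 ∷ []) (0 ∷ k ∷ y ∷ z ∷ []) (0<k ∷ k<y ∷ y<z ∷ [-]) refl
  ... | (y<z ∷ []) ∷ [] ∷ [] | (0<y , inj₂ y<k) ∷ (_ , inj₁ k<z) ∷ [] =
    coveredBy ΠB (2 ∷ 0 ∷ 1 ∷ 3 ∷ []) (0 ∷ y ∷ k ∷ z ∷ []) (0<y ∷ y<k ∷ k<z ∷ [-]) refl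
  ... | (y<z ∷ []) ∷ [] ∷ [] | (0<y , inj₂ _) ∷ (_ , inj₂ z<k) ∷ [] =
    coveredBy ΠB (3 ∷ 0 ∷ 1 ∷ 2 ∷ []) (0 ∷ y ∷ z ∷ k ∷ []) (0<y ∷ y<z ∷ z<k ∷ [-]) refl
  coverB e↗ {x = x} {y} {z} (refl ∷ _ ∷ʳ p) with AllPairs-resp-⊆ p e↗ | All-resp-⊆ p entries
  ... | (x<y ∷ _) ∷ (y<z ∷ []) ∷ [] ∷ [] | (_ , inj₁ k<x) ∷ _ =
    coveredBy ΠB (0 ∷ 1 ∷ 2 ∷ 3 ∷ []) (k ∷ x ∷ y ∷ z ∷ []) (k<x ∷ x<y ∷ y<z ∷ [-]) refl
  ... | (x<y ∷ _) ∷ (y<z ∷ []) ∷ [] ∷ [] | (_ , inj₂ x<k) ∷ (_ , inj₁ k<y) ∷ _ =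
    coveredBy ΠB (1 ∷ 0 ∷ 2 ∷ 3 ∷ []) (x ∷ k ∷ y ∷ z ∷ []) (x<k ∷ k<y ∷ y<z ∷ [-]) refl
  ... | (x<y ∷ _) ∷ (y<z ∷ []) ∷ [] ∷ [] | _ ∷ (_ , inj₂ y<k) ∷ (_ , inj₁ k<z) ∷ [] =
    coveredBy ΠB (2 ∷ 0 ∷ 1 ∷ 3 ∷ []) (x ∷ y ∷ k ∷ z ∷ []) (x<y ∷ y<k ∷ k<z ∷ [-]) refl
  ... | (x<y ∷ _) ∷ (y<z ∷ []) ∷ [] ∷ [] | _ ∷ _ ∷ (_ , inj₂ z<k) ∷ [] =
    coveredBy ΠB (3 ∷ 0 ∷ 1 ∷ 2 ∷ []) (x ∷ y ∷ z ∷ k ∷ []) (x<y ∷ y<z ∷ z<k ∷ [-]) refl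
  coverB e↗ {x = x} {y} {z} (_ ∷ʳ refl ∷ p) with AllPairs-resp-⊆ p e↗ | All-resp-⊆ p entries
  ... | (x<y ∷ _) ∷ (y<z ∷ []) ∷ [] ∷ [] | (0<x , _) ∷ _ =
    coveredBy ΠB (0 ∷ 1 ∷ 2 ∷ 3 ∷ []) (0 ∷ x ∷ y ∷ z ∷ []) (0<x ∷ x<y ∷ y<z ∷ [-]) refl
  coverB e↗ {w} {x} {y} {z} (_ ∷ʳ _ ∷ʳ p) with AllPairs-resp-⊆ p e↗
  ... | (w<x ∷ _) ∷ (x<y ∷ _) ∷ (y<z ∷ []) ∷ [] ∷ [] =
    coveredBy ΠB (0 ∷ 1 ∷ 2 ∷ 3 ∷ []) (w ∷ x ∷ y ∷ z ∷ []) (w<x ∷ x<y ∷ y<z ∷ [-]) refl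

  avoidsB⇒↗ : T (avoidsAll ΠB (0 ∷ e ++ [ k ])) → AllPairs _<_ e
  avoidsB⇒↗ avoids = AllPairs-from-⊆ e ascent
    where
    ascent : ∀ {y z} → y ∷ z ∷ [] ⊆ e → y < z
    ascent {y} {z} p with <-cmp-≢ (All.head (AllPairs.head (AllPairs-resp-⊆ p e-unique)))
    ... | inj₁ y<z = y<z
    ... | inj₂ z<y with All-resp-⊆ p entries
    ...   | (_ , inj₂ y<k) ∷ (0<z , _) ∷ [] =
            ⊥-elim (avoidsAll⇒¬occurrence ΠB avoids (here refl) (refl ∷ ⊆-++⁺ p ⊆-refl)
            (0 ∷ 2 ∷ 1 ∷ 3 ∷ []) (0 ∷ z ∷ y ∷ k ∷ []) (0<z ∷ z<y ∷ y<k ∷ [-]) refl _)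
    ...   | (_ , inj₁ k<y) ∷ (0<z , inj₂ z<k) ∷ [] =
            ⊥-elim (avoidsAll⇒¬occurrence ΠB avoids (there (here refl)) (refl ∷ ⊆-++⁺ p ⊆-refl)
            (0 ∷ 3 ∷ 1 ∷ 2 ∷ []) (0 ∷ z ∷ k ∷ y ∷ []) (0<z ∷ z<k ∷ k<y ∷ [-]) refl _)
    ...   | (_ , inj₁ _) ∷ (_ , inj₁ k<z) ∷ [] =
            ⊥-elim (avoidsAll⇒¬occurrence ΠB avoids (there (there (here refl))) (refl ∷ ⊆-++⁺ p ⊆-refl)
            (0 ∷ 3 ∷ 2 ∷ 1 ∷ []) (0 ∷ k ∷ z ∷ y ∷ []) (0<k ∷ k<z ∷ z<y ∷ [-]) refl _)

restB : ℕ → ℕ → List ℕ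
restB n k = remove 0 (remove k (upTo n))

restB-↗ : ∀ n k → AllPairs _<_ (restB n k)
restB-↗ n k = AllPairs-resp-⊆ (⊆-trans (remove-⊆ 0 _) (remove-⊆ k _)) (upTo-↗ n)

restB-↭ : ∀ {m k} → k ∈ labels m → k ∷ 0 ∷ restB (suc m) k ↭ downFrom (suc m)
restB-↭ {m} k∈ with ∈-labels⁻ k∈
... | k∈downFrom , k≢0 = ↭-trans
  (↭-sym (↭-remove₂ (∈-upTo⁺ (∈-downFrom⁻ k∈downFrom)) (∈-upTo⁺ (s≤s z≤n)) k≢0)) (upTo-↭-downFrom (suc m))

tailB : ℕ → ℕ → List ℕ
tailB n k = restB n k ++ [ k ]

tailsB : ℕ → List (List ℕ)
tailsB m = map (tailB (suc m)) (labels m)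

tailsB-spec : ∀ m {τ} →
  τ ∈ tailsB (suc m) ⇔ ((0 ∷ τ) ↭ downFrom (suc (suc m)) × T (avoidsAll ΠB (0 ∷ τ)))
tailsB-spec m = mk⇔ to from
  where
  to : ∀ {τ} → τ ∈ tailsB (suc m) → (0 ∷ τ) ↭ downFrom (suc (suc m)) × T (avoidsAll ΠB (0 ∷ τ))
  to τ∈ with ∈-map⁻ (tailB (suc (suc m))) τ∈
  ... | k , k∈ , refl = ↭-trans (↭-sym (Rotation⇒↭ rot)) (restB-↭ k∈) ,
    avoidsAll-resp-Rotation ΠB rot
      (avoidsAll-fromCover ΠB-length (coverB (↭-downFrom⇒Unique (restB-↭ k∈)) (restB-↗ (suc (suc m)) k)))
    where
    rot : Rotation (k ∷ 0 ∷ restB (suc (suc m)) k) (0 ∷ tailB (suc (suc m)) k)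
    rot = rotateOnce k (0 ∷ restB (suc (suc m)) k)
  from : ∀ {τ} → (0 ∷ τ) ↭ downFrom (suc (suc m)) × T (avoidsAll ΠB (0 ∷ τ)) → τ ∈ tailsB (suc m)
  from {τ} (p , avoids) with initLast τ
  ... | [] with ↭-length p
  ...   | ()
  from (p , avoids) | e ∷ʳ′ k =
    subst (λ e′ → (e′ ++ [ k ]) ∈ tailsB (suc m)) (sym e≡rest) (∈-map⁺ (tailB (suc (suc m))) k∈labels)
    where
    p′ : k ∷ 0 ∷ e ↭ downFrom (suc (suc m))
    p′ = ↭-trans (Rotation⇒↭ (rotateOnce k (0 ∷ e))) p
    u : Unique (k ∷ 0 ∷ e)
    u = ↭-downFrom⇒Unique p′
    k∈labels : k ∈ labels (suc m)
    k∈labels = ∈-labels⁺ (∈-resp-↭ p′ (here refl)) (All.head (AllPairs.head u))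
    e≡rest : e ≡ restB (suc (suc m)) k
    e≡rest = AllPairs-↭⇒≡ <-asym (avoidsB⇒↗ u avoids) (restB-↗ (suc (suc m)) k)
      (drop-∷ (drop-∷ (↭-trans p′ (↭-sym (restB-↭ k∈labels)))))

tailB-injective : ∀ n {k k′} → tailB n k ≡ tailB n k′ → k ≡ k′
tailB-injective n {k} {k′} eq = proj₂ (∷ʳ-injective (restB n k) (restB n k′) eq)

numAv-ΠB : ∀ m → numAv (suc (suc m)) ΠB ≡ suc m
numAv-ΠB m = numAv-byLabels (suc m) ΠB (tailB (suc (suc m))) (tailB-injective (suc (suc m))) (tailsB-spec m)

mainTheorem12 :
    ((n : ℕ) →
      numAv n ((1 ∷ 2 ∷ 3 ∷ 4 ∷ []) ∷ (1 ∷ 3 ∷ 2 ∷ 4 ∷ []) ∷ (1 ∷ 4 ∷ 2 ∷ 3 ∷ []) ∷ [])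
      ≡ numAv n ((1 ∷ 3 ∷ 2 ∷ 4 ∷ []) ∷ (1 ∷ 4 ∷ 2 ∷ 3 ∷ []) ∷ (1 ∷ 4 ∷ 3 ∷ 2 ∷ []) ∷ []))
    × ((n : ℕ) → 2 ≤ n →
      numAv n ((1 ∷ 2 ∷ 3 ∷ 4 ∷ []) ∷ (1 ∷ 3 ∷ 2 ∷ 4 ∷ []) ∷ (1 ∷ 4 ∷ 2 ∷ 3 ∷ []) ∷ [])
      ≡ n ∸ 1)
mainTheorem12 = numAv-ΠA≡numAv-ΠB , numAv-ΠA≡n∸1
  where
  numAv-ΠA≡numAv-ΠB : ∀ n → numAv n ΠA ≡ numAv n ΠB
  numAv-ΠA≡numAv-ΠB 0 = refl
  numAv-ΠA≡numAv-ΠB 1 = refl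
  numAv-ΠA≡numAv-ΠB (suc (suc m)) = trans (numAv-ΠA m) (sym (numAv-ΠB m))

  numAv-ΠA≡n∸1 : ∀ n → 2 ≤ n → numAv n ΠA ≡ n ∸ 1
  numAv-ΠA≡n∸1 (suc (suc m)) (s≤s (s≤s _)) = numAv-ΠA m
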